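{- Let $H=(V,E)$ be a hypergraph and $\lambda\in\mathbb{R}$. Suppose $V_1,V_2\subseteq V$ each induce a connected sub-hypergraph of $H$, both have strength greater than $\lambda$ in $H$, and $V_1\cap V_2\neq\emptyset$. Then $V_1\cup V_2$ has strength greater than $\lambda$ in $H$.
   Context: A hypergraph $H=(V,E)$ has a finite vertex set $V$ and a (multi)set $E$ of hyperedges, each a subset of $V$ with at least two vertices. For a partition of $V$ into nonempty parts $V_1,\dots,V_k$, $E[V_1,\dots,V_k]$ is the set of hyperedges not contained in any single part. $\Phi(H)=\min_{2\le k\le |V|}\min_{V_1\cup\dots\cup V_k=V}|E[V_1,\dots,V_k]|/(k-1)$ over partitions into $k$ nonempty parts. For $S\subseteq V$, $H[S]$ is the sub-hypergraph on $S$ of hyperedges contained in $S$; $S$ induces a connected sub-hypergraph if $S$ cannot be split into two nonempty parts with no hyperedge of $H[S]$ meeting both. Strength $\lambda_e$ is defined recursively: choose a partition $V_1,\dots,V_k$ attaining $\Phi(H)$; each $e\in E[V_1,\dots,V_k]$ gets $\lambda_e=\Phi(H)$; every other hyperedge lies in some $V_i$ and gets its strength recursively computed inside $H[V_i]$. The strength of a vertex set $S$ in $H$ is $\lambda_S=\min\{\lambda_e: e\in E,\ e\subseteq S\}$ (strengths computed in $H$), with $\lambda_S=+\infty$ if no hyperedge is contained in $S$.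
   Formalization: The threshold λ ranges only over the rationals instead of ℝ. -}

module Defs where

open import Data.Nat using (ℕ; zero; suc; _≤_)
open import Data.Integer using (+_)
open import Data.Fin using (Fin; _≟_)
open import Data.Fin.Properties using (any?)
open import Data.Fin.Subset using (Subset; _∈_; _∉_; _⊆_; ∣_∣)
open import Data.Fin.Subset.Properties using (_∈?_; _⊆?_)
open import Data.Fin.Subset renaming (⁅_⁆ to sing)
open import Data.List using (List; length; filter; foldr)
open import Data.List.Base using (allFin)
open import Data.Rational using (ℚ; _/_; _<_; _≤_; _⊓_)
open import Data.Product using (Σ; ∃; _×_; _,_)
open import Data.Bool using (Bool; true; false)
open import Relation.Nullary using (¬_; Dec; yes; no; ¬?)
open import Relation.Nullary.Decidable using (_×-dec_)
open import Relation.Binary.PropositionalEquality using (_≡_; _≢_)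

-- Hypergraphs on the vertex set Fin n, with m hyperedges indexed by
-- Fin m (so parallel hyperedges are allowed: E is a multiset).
-- Every hyperedge has at least two vertices.

record Hypergraph : Set where
  field
    n        : ℕ
    m        : ℕ
    edge     : Fin m → Subset n
    edgeSize : ∀ i → 2 Data.Nat.≤ ∣ edge i ∣

data ℚ∞ : Set where
  fin : ℚ → ℚ∞
  ∞   : ℚ∞

min∞ : ℚ∞ → ℚ∞ → ℚ∞
min∞ (fin p) (fin q) = fin (p ⊓ q)
min∞ (fin p) ∞       = fin p
min∞ ∞       y       = y

data _<∞_ : ℚ∞ → ℚ∞ → Set where
  fin<fin : ∀ {p q} → p Data.Rational.< q → fin p <∞ fin q
  fin<∞   : ∀ {p} → fin p <∞ ∞

module _ (H : Hypergraph) where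
  open Hypergraph H

  InS : Subset n → Fin m → Set
  InS S i = edge i ⊆ S

  -- A partition of S ⊆ V into k+2 nonempty parts, given by a labelling
  -- f : Fin n → Fin (2+k) (only the values on S matter).
  -- Part j is { v ∈ S | f v ≡ j }.

  IsPartition : (S : Subset n) (k : ℕ) → (Fin n → Fin (suc (suc k))) → Set
  IsPartition S k f = ∀ j → ∃ λ v → v ∈ S × f v ≡ j

  part : (S : Subset n) (k : ℕ) → (Fin n → Fin (suc (suc k))) →
         Fin (suc (suc k)) → Subset n
  part S k f j = S ∩ ⁅ (λ v → Relation.Nullary.Decidable.⌊ f v ≟ j ⌋) ⁆′
    where
      open import Data.Vec using (tabulate)
      ⁅_⁆′ : (Fin n → Bool) → Subset n
      ⁅ p ⁆′ = tabulate λ v → toSide (p v)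
        where
          toSide : Bool → Data.Fin.Subset.Side
          toSide true  = inside
          toSide false = outside

  Crosses : ∀ {k} → (Fin n → Fin k) → Subset n → Set
  Crosses f e = ∃ λ u → ∃ λ v → u ∈ e × v ∈ e × f u ≢ f v

  crosses? : ∀ {k} (f : Fin n → Fin k) (e : Subset n) → Dec (Crosses f e)
  crosses? f e = any? λ u → any? λ v →
    (u ∈? e) ×-dec (v ∈? e) ×-dec ¬? (f u ≟ f v)

  cutSize : (S : Subset n) {k : ℕ} → (Fin n → Fin k) → ℕ
  cutSize S f = length (filter (λ i → (edge i ⊆? S) ×-dec crosses? f (edge i)) (allFin m))

  -- |E[V₁,…,V_k]| / (k - 1), with k = k' + 2
  ratio : (S : Subset n) (k : ℕ) → (Fin n → Fin (suc (suc k))) → ℚ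
  ratio S k f = (+ cutSize S f) / suc k

  -- the partition f attains Φ(H[S])
  Optimal : (S : Subset n) (k : ℕ) → (Fin n → Fin (suc (suc k))) → Set
  Optimal S k f = ∀ k′ (g : Fin n → Fin (suc (suc k′))) →
    IsPartition S k′ g → ratio S k f Data.Rational.≤ ratio S k′ g

  -- σ : Fin m → ℚ is a strength assignment for H[S] obtained by the
  -- recursive procedure (for some choice of optimal partitions).
  -- Only values of σ on hyperedges of H[S] are constrained.

  data IsStrength (σ : Fin m → ℚ) : Subset n → Set where
    noEdges : ∀ {S} → (∀ i → ¬ InS S i) → IsStrength σ S
    split   : ∀ {S} k (f : Fin n → Fin (suc (suc k))) →
              IsPartition S k f → Optimal S k f →
              (∀ i → InS S i → Crosses f (edge i) → σ i ≡ ratio S k f) →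
              (∀ j → IsStrength σ (part S k f j)) →
              IsStrength σ S

  setStrength : (Fin m → ℚ) → Subset n → ℚ∞
  setStrength σ S = foldr (λ i acc → min∞ (fin (σ i)) acc) ∞
                          (filter (λ i → edge i ⊆? S) (allFin m))

  Connected : Subset n → Set
  Connected S = ¬ (Σ (Fin n → Bool) λ c →
      (∃ λ u → u ∈ S × c u ≡ true) ×
      (∃ λ v → v ∈ S × c v ≡ false) ×
      (∀ i → InS S i →
        ¬ ((∃ λ u → u ∈ edge i × c u ≡ true) ×
           (∃ λ v → v ∈ edge i × c v ≡ false))))

module Submission where

-- Every hyperedge inside a set S has strength at least Φ(H[S]): the hyperedges cut by the
-- optimal partition of S get exactly Φ(H[S]), and Φ can only grow when passing to a part Sⱼ,
-- since refining the optimal partition of S by a partition of Sⱼ and comparing ratios gives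
-- Φ(H[S]) ≤ Φ(H[Sⱼ]) by the mediant inequality.
--
-- Now follow the recursive decomposition down through the parts containing V₁ ∪ V₂, from a
-- common vertex w. If the optimal partition of the current set S separates some v ∈ Vₖ from w,
-- connectivity of Vₖ yields a hyperedge inside Vₖ cut by that partition; its strength is
-- Φ(H[S]) and exceeds λ, so every hyperedge inside V₁ ∪ V₂ ⊆ S has strength ≥ Φ(H[S]) > λ.
-- If the decomposition never separates V₁ ∪ V₂, it ends with no hyperedges inside it at all.

open import Defs
open import Data.Nat as ℕ using (ℕ; suc; z≤n; s≤s)
import Data.Nat.Properties as ℕP
import Data.Integer as ℤ
open import Data.Integer using (+_)
import Data.Integer.Properties as ℤP
open import Data.Rational as ℚ using (ℚ; _/_; fromℚᵘ)
import Data.Rational.Properties as ℚP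
import Data.Rational.Unnormalised as ℚᵘ
import Data.Rational.Unnormalised.Properties as ℚᵘP
open import Data.Fin as F using (Fin; _↑ˡ_; _↑ʳ_; splitAt)
open import Data.Fin.Properties using (any?; splitAt⁻¹-↑ˡ; splitAt⁻¹-↑ʳ)
open import Data.Fin.Subset using (Subset; ⊤; _∩_; _∪_; Nonempty; _∈_; _⊆_; ∣_∣)
open import Data.Fin.Subset.Properties
  using (_∈?_; _⊆?_; x∈p∩q⁺; x∈p∩q⁻; x∈p∪q⁺; x∈p∪q⁻; ∈⊤; nonempty?; Empty-unique; ∣⊥∣≡0)
open import Data.List using ([]; _∷_; length; filter; foldr)
open import Data.List.Base using (allFin)
open import Data.List.Relation.Unary.All as All using (All; []; _∷_)
open import Data.List.Relation.Unary.All.Properties using (all-filter)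
open import Data.List.Membership.Propositional.Properties using (∈-allFin; ∈-filter⁺)
open import Data.Product using (∃; _×_; _,_; proj₁; proj₂)
open import Data.Sum using (_⊎_; inj₁; inj₂; [_,_]′)
open import Data.Bool using (Bool; true; false; _∧_)
open import Data.Empty using (⊥-elim)
open import Data.Vec using (lookup)
open import Data.Vec.Properties using (lookup∘tabulate; lookup-zipWith; []=⇒lookup; lookup⇒[]=)
open import Relation.Nullary using (¬_; Dec; yes; no; ¬?; does; contradiction)
open import Relation.Nullary.Decidable using (_×-dec_; dec-true; dec-false)
import Relation.Unary as U
open import Relation.Binary.PropositionalEquality

fromℚᵘ-mono-≤ : ∀ {p q} → p ℚᵘ.≤ q → fromℚᵘ p ℚ.≤ fromℚᵘ q
fromℚᵘ-mono-≤ {p} {q} p≤q = ℚP.toℚᵘ-cancel-≤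
  (ℚᵘP.≤-respʳ-≃ (ℚᵘP.≃-sym (ℚP.toℚᵘ-fromℚᵘ q))
    (ℚᵘP.≤-respˡ-≃ (ℚᵘP.≃-sym (ℚP.toℚᵘ-fromℚᵘ p)) p≤q))

fromℚᵘ-cancel-≤ : ∀ {p q} → fromℚᵘ p ℚ.≤ fromℚᵘ q → p ℚᵘ.≤ q
fromℚᵘ-cancel-≤ {p} {q} le =
  ℚᵘP.≤-respʳ-≃ (ℚP.toℚᵘ-fromℚᵘ q) (ℚᵘP.≤-respˡ-≃ (ℚP.toℚᵘ-fromℚᵘ p) (ℚP.toℚᵘ-mono-≤ le))

+/suc-≤⇒*-≤ : ∀ a b c d → + a / suc b ℚ.≤ + c / suc d → a ℕ.* suc d ℕ.≤ c ℕ.* suc b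
+/suc-≤⇒*-≤ a b c d le with fromℚᵘ-cancel-≤ {ℚᵘ.mkℚᵘ (+ a) b} {ℚᵘ.mkℚᵘ (+ c) d} le
... | ℚᵘ.*≤* le′ = ℤP.drop‿+≤+ (subst₂ ℤ._≤_ (sym (ℤP.pos-* a (suc d))) (sym (ℤP.pos-* c (suc b))) le′)

*-≤⇒+/suc-≤ : ∀ a b c d → a ℕ.* suc d ℕ.≤ c ℕ.* suc b → + a / suc b ℚ.≤ + c / suc d
*-≤⇒+/suc-≤ a b c d le = fromℚᵘ-mono-≤ {ℚᵘ.mkℚᵘ (+ a) b} {ℚᵘ.mkℚᵘ (+ c) d}
  (ℚᵘ.*≤* (subst₂ ℤ._≤_ (ℤP.pos-* a (suc d)) (ℤP.pos-* c (suc b)) (ℤ.+≤+ le)))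

-- c/K ≤ (c + c′)/(K + P) implies c/K ≤ c′/P, with denominators cleared.
mediant-≤ : ∀ c c′ K P → c ℕ.* (K ℕ.+ P) ℕ.≤ (c ℕ.+ c′) ℕ.* K → c ℕ.* P ℕ.≤ c′ ℕ.* K
mediant-≤ c c′ K P le = ℕP.+-cancelˡ-≤ (c ℕ.* K) _ _ (begin
  c ℕ.* K ℕ.+ c ℕ.* P   ≡⟨ ℕP.*-distribˡ-+ c K P ⟨
  c ℕ.* (K ℕ.+ P)       ≤⟨ le ⟩
  (c ℕ.+ c′) ℕ.* K      ≡⟨ ℕP.*-distribʳ-+ K c c′ ⟩
  c ℕ.* K ℕ.+ c′ ℕ.* K  ∎)
  where open ℕP.≤-Reasoning

length-filter-⊆-∪ : ∀ {A : Set} {P Q R : A → Set}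
  (P? : U.Decidable P) (Q? : U.Decidable Q) (R? : U.Decidable R) → P U.⊆ Q U.∪ R →
  ∀ xs → length (filter P? xs) ℕ.≤ length (filter Q? xs) ℕ.+ length (filter R? xs)
length-filter-⊆-∪ P? Q? R? P⊆Q∪R [] = z≤n
length-filter-⊆-∪ P? Q? R? P⊆Q∪R (x ∷ xs)
  with ih ← length-filter-⊆-∪ P? Q? R? P⊆Q∪R xs | P? x | Q? x | R? x
... | no _   | no _   | no _   = ih
... | no _   | yes _  | no _   = ℕP.m≤n⇒m≤1+n ih
... | no _   | no _   | yes _  = ℕP.≤-trans ih (ℕP.+-monoʳ-≤ _ (ℕP.n≤1+n _))
... | no _   | yes _  | yes _  = ℕP.m≤n⇒m≤1+n (ℕP.≤-trans ih (ℕP.+-monoʳ-≤ _ (ℕP.n≤1+n _)))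
... | yes _  | yes _  | no _   = s≤s ih
... | yes _  | yes _  | yes _  = s≤s (ℕP.≤-trans ih (ℕP.+-monoʳ-≤ _ (ℕP.n≤1+n _)))
... | yes _  | no _   | yes _  = ℕP.≤-trans (s≤s ih) (ℕP.≤-reflexive (sym (ℕP.+-suc _ _)))
... | yes px | no ¬qx | no ¬rx = ⊥-elim ([ ¬qx , ¬rx ]′ (P⊆Q∪R px))

x≡true⇒x∧y≡y : ∀ {x y} → x ≡ true → x ∧ y ≡ y
x≡true⇒x∧y≡y refl = refl

<min∞⁺ : ∀ {q y z} → fin q <∞ y → fin q <∞ z → fin q <∞ min∞ y z
<min∞⁺ {y = ∞}                     _            q<z          = q<z
<min∞⁺ {y = fin a} {z = ∞}         q<y          _            = q<y
<min∞⁺ {q} {y = fin a} {z = fin b} (fin<fin q<a) (fin<fin q<b) =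
  fin<fin ([ (λ a⊓b≡a → subst (q ℚ.<_) (sym a⊓b≡a) q<a)
           , (λ a⊓b≡b → subst (q ℚ.<_) (sym a⊓b≡b) q<b) ]′ (ℚP.⊓-sel a b))

<min∞⁻ : ∀ {q y z} → fin q <∞ min∞ y z → fin q <∞ y × fin q <∞ z
<min∞⁻ {y = ∞}                     q<z           = fin<∞ , q<z
<min∞⁻ {y = fin a} {z = ∞}         q<y           = q<y , fin<∞
<min∞⁻ {y = fin a} {z = fin b} (fin<fin q<a⊓b) =
  fin<fin (ℚP.<-≤-trans q<a⊓b (ℚP.p⊓q≤p a b)) , fin<fin (ℚP.<-≤-trans q<a⊓b (ℚP.p⊓q≤q a b))

module _ {A : Set} (w : A → ℚ) (q : ℚ) where

  <minimum⁺ : ∀ {xs} → All (λ x → q ℚ.< w x) xs → fin q <∞ foldr (λ x → min∞ (fin (w x))) ∞ xs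
  <minimum⁺ []           = fin<∞
  <minimum⁺ (q<wx ∷ q<ws) = <min∞⁺ (fin<fin q<wx) (<minimum⁺ q<ws)

  <minimum⁻ : ∀ xs → fin q <∞ foldr (λ x → min∞ (fin (w x))) ∞ xs → All (λ x → q ℚ.< w x) xs
  <minimum⁻ []       _  = []
  <minimum⁻ (x ∷ xs) lt with <min∞⁻ {y = fin (w x)} lt
  ... | fin<fin q<wx , q<rest = q<wx ∷ <minimum⁻ xs q<rest

module _ (H : Hypergraph) where
  open Hypergraph H

  edge-nonempty : ∀ i → Nonempty (edge i)
  edge-nonempty i with nonempty? (edge i)
  ... | yes nonempty = nonempty
  ... | no empty = contradiction
        (subst (2 ℕ.≤_) (trans (cong ∣_∣ (Empty-unique empty)) (∣⊥∣≡0 n)) (edgeSize i)) λ ()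

  ∈part⁻ : ∀ {S k f j v} → v ∈ part H S k f j → v ∈ S × f v ≡ j
  ∈part⁻ {S} {k} {f} {j} {v} v∈part with x∈p∩q⁻ S _ v∈part
  ... | v∈S , v∈block with f v F.≟ j | trans (sym (lookup∘tabulate _ v)) ([]=⇒lookup v∈block)
  ...   | yes fv≡j | _  = v∈S , fv≡j
  ...   | no _     | ()

  ∈part⁺ : ∀ {S k f v} → v ∈ S → v ∈ part H S k f (f v)
  ∈part⁺ {S} {k} {f} {v} v∈S with lookup (part H S k f (f v)) v in lookup≡
  ... | true  = lookup⇒[]= v _ lookup≡
  ... | false with f v F.≟ f v
        | trans (sym (lookup∘tabulate _ v))
            (trans (sym (x≡true⇒x∧y≡y ([]=⇒lookup v∈S)))
              (trans (sym (lookup-zipWith _∧_ v S _)) lookup≡))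
  ...   | yes _    | ()
  ...   | no fv≢fv | _ = contradiction refl fv≢fv

  uncrossed-constant : ∀ {k} {f : Fin n → Fin k} {e u w} →
                       ¬ Crosses H f e → u ∈ e → w ∈ e → f w ≡ f u
  uncrossed-constant {f = f} {u = u} {w} ¬cross u∈e w∈e with f w F.≟ f u
  ... | yes fw≡fu = fw≡fu
  ... | no fw≢fu  = contradiction (w , u , w∈e , u∈e , fw≢fu) ¬cross

  uncrossed⊆part : ∀ {S k f i u} → InS H S i → ¬ Crosses H f (edge i) → u ∈ edge i →
                   InS H (part H S k f (f u)) i
  uncrossed⊆part {f = f} i∈S ¬cross u∈e {w} w∈e =
    subst (λ j → w ∈ part H _ _ f j) (uncrossed-constant ¬cross u∈e w∈e) (∈part⁺ (i∈S w∈e))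

  module Refinement {S : Subset n} {k : ℕ} (f : Fin n → Fin (suc (suc k))) (j : Fin (suc (suc k)))
                    {p : ℕ} (g : Fin n → Fin (suc (suc p))) where

    relabel : Fin (suc (suc p)) → Fin (suc (suc k) ℕ.+ suc p)
    relabel F.zero    = j ↑ˡ suc p
    relabel (F.suc t) = suc (suc k) ↑ʳ t

    refine : Fin n → Fin (suc (suc (k ℕ.+ suc p)))
    refine v with f v F.≟ j
    ... | yes _ = relabel (g v)
    ... | no _  = f v ↑ˡ suc p

    refine-inside : ∀ {v} → f v ≡ j → refine v ≡ relabel (g v)
    refine-inside {v} fv≡j with f v F.≟ j
    ... | yes _    = refl
    ... | no fv≢j  = contradiction fv≡j fv≢j

    refine-outside : ∀ {v} → f v ≢ j → refine v ≡ f v ↑ˡ suc p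
    refine-outside {v} fv≢j with f v F.≟ j
    ... | yes fv≡j = contradiction fv≡j fv≢j
    ... | no _     = refl

    refine-isPartition : IsPartition H S k f → IsPartition H (part H S k f j) p g →
                         IsPartition H S (k ℕ.+ suc p) refine
    refine-isPartition onto-f onto-g l with splitAt (suc (suc k)) l in split≡
    ... | inj₂ t with onto-g (F.suc t)
    ...   | v , v∈part , gv≡t+1 with ∈part⁻ v∈part
    ...     | v∈S , fv≡j = v , v∈S ,
              trans (refine-inside fv≡j) (trans (cong relabel gv≡t+1) (splitAt⁻¹-↑ʳ split≡))
    refine-isPartition onto-f onto-g l | inj₁ x with x F.≟ j
    ... | yes refl with onto-g F.zero
    ...   | v , v∈part , gv≡0 with ∈part⁻ v∈part
    ...     | v∈S , fv≡j = v , v∈S ,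
              trans (refine-inside fv≡j) (trans (cong relabel gv≡0) (splitAt⁻¹-↑ˡ split≡))
    refine-isPartition onto-f onto-g l | inj₁ x | no x≢j with onto-f x
    ... | v , v∈S , fv≡x = v , v∈S ,
          trans (refine-outside (λ fv≡j → x≢j (trans (sym fv≡x) fv≡j)))
                (trans (cong (_↑ˡ suc p) fv≡x) (splitAt⁻¹-↑ˡ split≡))

    refine-crosses : ∀ i → InS H S i × Crosses H refine (edge i) →
                     (InS H S i × Crosses H f (edge i)) ⊎
                     (InS H (part H S k f j) i × Crosses H g (edge i))
    refine-crosses i (i∈S , u , v , u∈e , v∈e , ru≢rv) with crosses? H f (edge i)
    ... | yes f-crosses = inj₁ (i∈S , f-crosses)
    ... | no ¬f-crosses = by-block-of-u (f u F.≟ j)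
      where
        fv≡fu : f v ≡ f u
        fv≡fu = uncrossed-constant ¬f-crosses u∈e v∈e

        by-block-of-u : Dec (f u ≡ j) → (InS H S i × Crosses H f (edge i)) ⊎
                                         (InS H (part H S k f j) i × Crosses H g (edge i))
        by-block-of-u (yes fu≡j) = inj₂ (i∈part , u , v , u∈e , v∈e , λ gu≡gv →
          ru≢rv (trans (refine-inside fu≡j)
                  (trans (cong relabel gu≡gv) (sym (refine-inside (trans fv≡fu fu≡j))))))
          where
            i∈part : InS H (part H S k f j) i
            i∈part = subst (λ l → InS H (part H S k f l) i) fu≡j (uncrossed⊆part i∈S ¬f-crosses u∈e)
        by-block-of-u (no fu≢j) = contradiction
          (trans (refine-outside fu≢j)
            (trans (cong (_↑ˡ suc p) (sym fv≡fu))
              (sym (refine-outside (λ fv≡j → fu≢j (trans (sym fv≡fu) fv≡j))))))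
          ru≢rv

    cutSize-refine : cutSize H S refine ℕ.≤ cutSize H S f ℕ.+ cutSize H (part H S k f j) g
    cutSize-refine = length-filter-⊆-∪ _ _ _ (refine-crosses _) (allFin m)

  optimal≤part-ratio : ∀ {S k f p g} j → IsPartition H S k f → Optimal H S k f →
                       IsPartition H (part H S k f j) p g → ratio H S k f ℚ.≤ ratio H (part H S k f j) p g
  optimal≤part-ratio {S} {k} {f} {p} {g} j onto-f optimal onto-g =
    *-≤⇒+/suc-≤ cut k cutⱼ p (mediant-≤ cut cutⱼ (suc k) (suc p) (ℕP.≤-trans
      (+/suc-≤⇒*-≤ cut k (cutSize H S refine) (k ℕ.+ suc p)
        (optimal (k ℕ.+ suc p) refine (refine-isPartition onto-f onto-g)))
      (ℕP.*-monoˡ-≤ (suc k) cutSize-refine)))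
    where
      open Refinement f j g
      cut cutⱼ : ℕ
      cut  = cutSize H S f
      cutⱼ = cutSize H (part H S k f j) g

  _≤Φ_ : ℚ → Subset n → Set
  q ≤Φ S = ∀ k g → IsPartition H S k g → q ℚ.≤ ratio H S k g

  ≤Φ⇒≤strength : ∀ {σ S q} → IsStrength H σ S → q ≤Φ S → ∀ i → InS H S i → q ℚ.≤ σ i
  ≤Φ⇒≤strength (noEdges none) _ i i∈S = ⊥-elim (none i i∈S)
  ≤Φ⇒≤strength {σ} {q = q} (split k f onto optimal σ≡ratio parts) q≤Φ i i∈S =
    by-crossing (crosses? H f (edge i)) (edge-nonempty i)
    where
      by-crossing : Dec (Crosses H f (edge i)) → Nonempty (edge i) → q ℚ.≤ σ i
      by-crossing (yes crosses) _ = subst (q ℚ.≤_) (sym (σ≡ratio i i∈S crosses)) (q≤Φ k f onto)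
      by-crossing (no ¬crosses) (u , u∈e) = ≤Φ⇒≤strength (parts (f u))
        (λ k′ g onto-g → ℚP.≤-trans (q≤Φ k f onto) (optimal≤part-ratio (f u) onto optimal onto-g))
        i (uncrossed⊆part i∈S ¬crosses u∈e)

  connected⇒crossing : ∀ {X k} (f : Fin n → Fin k) {u v} → Connected H X →
                       u ∈ X → v ∈ X → f v ≢ f u → ∃ λ i → InS H X i × Crosses H f (edge i)
  connected⇒crossing {X} f {u} {v} connected u∈X v∈X fv≢fu
    with any? (λ i → (edge i ⊆? X) ×-dec crosses? H f (edge i))
  ... | yes crossing = crossing
  ... | no ¬crossing = contradiction
          (sameBlock , (u , u∈X , dec-true (f u F.≟ f u) refl) , (v , v∈X , dec-false (f v F.≟ f u) fv≢fu) ,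
           λ i i∈X ((x , x∈e , x-same) , (y , y∈e , y-other)) →
             ¬crossing (i , i∈X , x , y , x∈e , y∈e , λ fx≡fy →
               contradiction (trans (sym (dec-true (f y F.≟ f u) (trans (sym fx≡fy) (same⇒≡ x-same)))) y-other)
                 λ ()))
          connected
    where
      sameBlock : Fin n → Bool
      sameBlock x = does (f x F.≟ f u)

      same⇒≡ : ∀ {x} → does (f x F.≟ f u) ≡ true → f x ≡ f u
      same⇒≡ {x} with f x F.≟ f u
      ... | yes fx≡fu = λ _ → fx≡fu
      ... | no _      = λ ()

  module _ (σ : Fin m → ℚ) (lam : ℚ) where

    EdgesAbove : Subset n → Set
    EdgesAbove S = ∀ i → InS H S i → lam ℚ.< σ i

    <setStrength⁺ : ∀ S → EdgesAbove S → fin lam <∞ setStrength H σ S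
    <setStrength⁺ S above = <minimum⁺ σ lam
      (All.map {P = InS H S} (λ {i} i∈S → above i i∈S) (all-filter (λ i → edge i ⊆? S) (allFin m)))

    <setStrength⁻ : ∀ S → fin lam <∞ setStrength H σ S → EdgesAbove S
    <setStrength⁻ S lam<λS i i∈S = All.lookup (<minimum⁻ σ lam _ lam<λS)
      (∈-filter⁺ (λ i → edge i ⊆? S) (∈-allFin i) i∈S)

    separated⇒<ratio : ∀ {S k f X u v} → Connected H X → EdgesAbove X → X ⊆ S →
                       u ∈ X → v ∈ X → f v ≢ f u →
                       (∀ i → InS H S i → Crosses H f (edge i) → σ i ≡ ratio H S k f) →
                       lam ℚ.< ratio H S k f
    separated⇒<ratio {S} {k} {f} {X} connected above X⊆S u∈X v∈X fv≢fu σ≡ratio =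
      crossing⇒<ratio (connected⇒crossing f connected u∈X v∈X fv≢fu)
      where
        crossing⇒<ratio : (∃ λ i → InS H X i × Crosses H f (edge i)) → lam ℚ.< ratio H S k f
        crossing⇒<ratio (i , i∈X , crosses) =
          subst (lam ℚ.<_) (σ≡ratio i (λ x∈e → X⊆S (i∈X x∈e)) crosses) (above i i∈X)

    module _ {V₁ V₂ : Subset n} (connected₁ : Connected H V₁) (connected₂ : Connected H V₂)
             (above₁ : EdgesAbove V₁) (above₂ : EdgesAbove V₂)
             {w : Fin n} (w∈V₁ : w ∈ V₁) (w∈V₂ : w ∈ V₂) where

      ∪-edgesAbove : ∀ {S} → IsStrength H σ S → V₁ ∪ V₂ ⊆ S → EdgesAbove (V₁ ∪ V₂)
      ∪-edgesAbove (noEdges none) ∪⊆S i i∈∪ = ⊥-elim (none i (λ x∈e → ∪⊆S (i∈∪ x∈e)))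
      ∪-edgesAbove {S} strength@(split k f _ optimal σ≡ratio parts) ∪⊆S i i∈∪ =
        by-separation (any? (λ v → (v ∈? V₁ ∪ V₂) ×-dec ¬? (f v F.≟ f w)))
        where
          lam<ratio : ∀ {v} → v ∈ V₁ ⊎ v ∈ V₂ → f v ≢ f w → lam ℚ.< ratio H S k f
          lam<ratio (inj₁ v∈V₁) fv≢fw = separated⇒<ratio connected₁ above₁
            (λ x∈V₁ → ∪⊆S (x∈p∪q⁺ (inj₁ x∈V₁))) w∈V₁ v∈V₁ fv≢fw σ≡ratio
          lam<ratio (inj₂ v∈V₂) fv≢fw = separated⇒<ratio connected₂ above₂
            (λ x∈V₂ → ∪⊆S (x∈p∪q⁺ (inj₂ x∈V₂))) w∈V₂ v∈V₂ fv≢fw σ≡ratio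

          ∪⊆part : (¬ ∃ λ v → v ∈ V₁ ∪ V₂ × f v ≢ f w) → V₁ ∪ V₂ ⊆ part H S k f (f w)
          ∪⊆part ¬separated {x} x∈∪ with f x F.≟ f w
          ... | yes fx≡fw = subst (λ j → x ∈ part H S k f j) fx≡fw (∈part⁺ (∪⊆S x∈∪))
          ... | no fx≢fw  = contradiction (x , x∈∪ , fx≢fw) ¬separated

          by-separation : Dec (∃ λ v → v ∈ V₁ ∪ V₂ × f v ≢ f w) → lam ℚ.< σ i
          by-separation (yes (v , v∈∪ , fv≢fw)) = ℚP.<-≤-trans (lam<ratio (x∈p∪q⁻ V₁ V₂ v∈∪) fv≢fw)
            (≤Φ⇒≤strength strength optimal i (λ x∈e → ∪⊆S (i∈∪ x∈e)))
          by-separation (no ¬separated) = ∪-edgesAbove (parts (f w)) (∪⊆part ¬separated) i i∈∪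

mainTheorem11 : (H : Hypergraph) →
    let open Hypergraph H in
    (σ : Fin m → ℚ) → IsStrength H σ ⊤ →
    (lam : ℚ) (V₁ V₂ : Subset n) →
    Connected H V₁ → Connected H V₂ →
    fin lam <∞ (setStrength H σ V₁) →
    fin lam <∞ (setStrength H σ V₂) →
    Nonempty (V₁ ∩ V₂) →
    fin lam <∞ (setStrength H σ (V₁ ∪ V₂))
mainTheorem11 H σ strength lam V₁ V₂ connected₁ connected₂ lam<λ₁ lam<λ₂ (w , w∈V₁∩V₂) =
  <setStrength⁺ H σ lam (V₁ ∪ V₂)
    (∪-edgesAbove H σ lam connected₁ connected₂
      (<setStrength⁻ H σ lam V₁ lam<λ₁) (<setStrength⁻ H σ lam V₂ lam<λ₂)
      w∈V₁ w∈V₂ strength (λ _ → ∈⊤))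
  where
    w∈V₁ : w ∈ V₁
    w∈V₁ = proj₁ (x∈p∩q⁻ V₁ V₂ w∈V₁∩V₂)

    w∈V₂ : w ∈ V₂
    w∈V₂ = proj₂ (x∈p∩q⁻ V₁ V₂ w∈V₁∩V₂)
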